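{- Let $((p_i/q_i),(r_j/s_j))$ and $((p_i'/q_i'),(r_j'/s_j'))$ be two pairs of normalised paths and $M=(p_i/q_i)\cdot(r_j/s_j)$, $M'=(p_i'/q_i')\cdot(r_j'/s_j')$ be their scalar products. If $M$ is equivalent to $M'$ then there exists a matrix $A\in SL_2({\mathbb Z}[\sigma])$ and normalisations $p_i''/q_i''$ and $r_j''/s_j''$ of $p_i'/q_i'$ and $r_j'/s_j'$ respectively such that $$\begin{pmatrix} p_i''\\ q_i''\end{pmatrix}=A\begin{pmatrix} p_i\\ q_i\end{pmatrix},\qquad \begin{pmatrix} r_j''\\ s_j''\end{pmatrix}=(A^T)^{ -1}\begin{pmatrix} r_j\\ s_j\end{pmatrix}.$$
   Context: Let $\sigma=e^{i\pi/3}$ and ${\mathbb Z}[\sigma]$ the Eisenstein integers (units are the six powers of $\sigma$). A fraction $p/q$ with $p,q\in{\mathbb Z}[\sigma]$ is irreducible if any common factor of $p,q$ is a unit. Let $\mathcal T$ be the tetrahedral graph: vertices $\widehat{\mathbb Q}(\sigma)$, with irreducible fractions $p/q$, $r/s$ joined by an edge iff $|ps-rq|=1$. A path $(v_i)$ is normalised if represented by irreducible fractions $v_i=p_i/q_i$ with $p_iq_{i+1}-p_{i+1}q_i=1$ for all $i$; a path has exactly six normalisations, obtained from one another by multiplying $p_i$ and $q_i$ by $\sigma^{(-1)^i k}$. The scalar product of bi-infinite normalised paths $(p_i/q_i)$, $(r_j/s_j)$ is the matrix $(m_{i,j})$ with $m_{i,j}=p_ir_j+q_is_j$; it is a tame $SL_2({\mathbb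 Z}[\sigma])$-tiling. Two $SL_2({\mathbb Z}[\sigma])$-tilings are called equivalent if they are scalar products of different normalisations of the same pair of paths. -}

module Defs where

open import Data.Nat using (ℕ; zero; suc)
open import Data.Integer as ℤ using (ℤ; +_; -[1+_]; ∣_∣)
open import Data.Bool using (Bool; true; false; if_then_else_)
open import Data.Product using (Σ; _×_; _,_)
open import Relation.Binary.PropositionalEquality using (_≡_)

-- Eisenstein integers ℤ[σ], σ = e^{iπ/3}, σ² = σ - 1.
-- An element a + bσ is represented uniquely by the pair (a , b).

record 𝔼 : Set where
  constructor _+_σ
  field
    re : ℤ
    im : ℤ
open 𝔼 public

infixl 6 _+ᴱ_ _-ᴱ_
infixl 7 _*ᴱ_

_+ᴱ_ : 𝔼 → 𝔼 → 𝔼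
(a + b σ) +ᴱ (c + d σ) = (a ℤ.+ c) + (b ℤ.+ d) σ

-ᴱ_ : 𝔼 → 𝔼
-ᴱ (a + b σ) = (ℤ.- a) + (ℤ.- b) σ

_-ᴱ_ : 𝔼 → 𝔼 → 𝔼
x -ᴱ y = x +ᴱ (-ᴱ y)

-- (a + bσ)(c + dσ) = (ac - bd) + (ad + bc + bd)σ   using σ² = σ - 1
_*ᴱ_ : 𝔼 → 𝔼 → 𝔼
(a + b σ) *ᴱ (c + d σ) =
  (a ℤ.* c ℤ.- b ℤ.* d) + (a ℤ.* d ℤ.+ b ℤ.* c ℤ.+ b ℤ.* d) σ

0ᴱ 1ᴱ σᴱ σ⁻¹ᴱ : 𝔼
0ᴱ = (+ 0) + (+ 0) σ
1ᴱ = (+ 1) + (+ 0) σ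
σᴱ = (+ 0) + (+ 1) σ
σ⁻¹ᴱ = (+ 1) + (ℤ.- (+ 1)) σ   -- 1 - σ = σ⁻¹

σ^ℕ : 𝔼 → ℕ → 𝔼
σ^ℕ x zero = 1ᴱ
σ^ℕ x (suc n) = x *ᴱ σ^ℕ x n

σ^ : ℤ → 𝔼
σ^ (+ n) = σ^ℕ σᴱ n
σ^ -[1+ n ] = σ^ℕ σ⁻¹ᴱ (suc n)

evenℕ : ℕ → Bool
evenℕ zero = true
evenℕ (suc n) with evenℕ n
... | true = false
... | false = true

altSign : ℤ → ℤ → ℤ
altSign i k = if evenℕ ∣ i ∣ then k else ℤ.- k

-- Bi-infinite sequences of fractions p_i/q_i, given by numerators and
-- denominators.

Seq : Set
Seq = ℤ → 𝔼

IsNormalised : Seq → Seq → Set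
IsNormalised p q = ∀ i → p i *ᴱ q (ℤ.suc i) -ᴱ p (ℤ.suc i) *ᴱ q i ≡ 1ᴱ

normalise : ℤ → Seq → Seq
normalise k p i = σ^ (altSign i k) *ᴱ p i

scalarProduct : Seq → Seq → Seq → Seq → ℤ → ℤ → 𝔼
scalarProduct p q r s i j = p i *ᴱ r j +ᴱ q i *ᴱ s j

Tiling : Set
Tiling = ℤ → ℤ → 𝔼

Equivalent : Tiling → Tiling → Set
Equivalent M M' =
  Σ Seq λ p → Σ Seq λ q → Σ Seq λ r → Σ Seq λ s →
  IsNormalised p q × IsNormalised r s ×
  Σ ℤ λ k → Σ ℤ λ l →
    (∀ i j → M i j ≡ scalarProduct p q r s i j) ×
    (∀ i j → M' i j ≡ scalarProduct (normalise k p) (normalise k q)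
                                    (normalise l r) (normalise l s) i j)

record SL₂ : Set where
  constructor mat
  field
    a b c d : 𝔼
    det≡1 : a *ᴱ d -ᴱ b *ᴱ c ≡ 1ᴱ
open SL₂ public

_·ᵛ_ : SL₂ → 𝔼 × 𝔼 → 𝔼 × 𝔼
A ·ᵛ (x , y) = (a A *ᴱ x +ᴱ b A *ᴱ y) , (c A *ᴱ x +ᴱ d A *ᴱ y)

-- (A^T)^{-1} for A = (a b; c d) with det A = 1 is the matrix (d -c; -b a);
-- this is its action on a column vector
invT·ᵛ : SL₂ → 𝔼 × 𝔼 → 𝔼 × 𝔼
invT·ᵛ A (x , y) = (d A *ᴱ x -ᴱ c A *ᴱ y) , (a A *ᴱ y -ᴱ b A *ᴱ x)

{-# OPTIONS --safe #-}
-- Write vᵢ = (pᵢ, qᵢ) and wⱼ = (rⱼ, sⱼ), so that the tiling is the Gram matrix vᵢ · wⱼ. Consecutive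
-- vectors of a normalised path form a basis of determinant 1, and a Gram matrix determines such
-- families up to vᵢ ↦ A vᵢ, wⱼ ↦ A⁻ᵀ wⱼ with A ∈ SL₂(ℤ[σ]): A is forced by where it sends one
-- basis vᵢ₀, vᵢ₁, and any vector is recovered from its products with a unimodular basis (Cramer).
-- Renormalising (p', q') by σ^{∓k} and (r', s') by σ^{∓l} turns the equivalent tiling back into
-- the same Gram matrix.
module Submission where

open import Defs
open import Data.Integer as ℤ using (ℤ; +_; -[1+_])
import Data.Integer.Properties as ℤ
open import Data.Nat.Base using (zero; suc)
open import Data.Bool.Base using (true; false; not; if_then_else_)
open import Data.Bool.Properties using (not-involutive)
open import Data.Product.Base using (Σ; _×_; _,_; proj₁; proj₂)
open import Data.Maybe.Base using (Maybe; just; nothing)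
open import Level using (0ℓ)
open import Relation.Binary.PropositionalEquality
open import Algebra.Bundles using (CommutativeRing)
import Algebra.Properties.CommutativeSemigroup as CommutativeSemigroupProperties
import Tactic.RingSolver.Core.AlmostCommutativeRing as ACR
import Tactic.RingSolver as RingSolver
open import Algebra.Consequences.Propositional
  using (comm∧idˡ⇒id; comm∧idˡ⇒idʳ; comm∧invˡ⇒inv; comm∧distrˡ⇒distrʳ)

-- The reflective solver does not see through the record projections of 𝔼, so its ring laws are
-- checked coordinatewise over ℤ.
private module ComponentIdentities where
  open import Data.Integer using (_+_; _*_; _-_)
  open import Data.Integer.Tactic.RingSolver using (solve-∀)

  re-*-assoc : ∀ a b c d e f →
    (a * c - b * d) * e - (a * d + b * c + b * d) * f ≡
    a * (c * e - d * f) - b * (c * f + d * e + d * f)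
  re-*-assoc = solve-∀

  im-*-assoc : ∀ a b c d e f →
    (a * c - b * d) * f + (a * d + b * c + b * d) * e + (a * d + b * c + b * d) * f ≡
    a * (c * f + d * e + d * f) + b * (c * e - d * f) + b * (c * f + d * e + d * f)
  im-*-assoc = solve-∀

  re-*-comm : ∀ a b c d → a * c - b * d ≡ c * a - d * b
  re-*-comm = solve-∀

  im-*-comm : ∀ a b c d → a * d + b * c + b * d ≡ c * b + d * a + d * b
  im-*-comm = solve-∀

  re-*-identityˡ : ∀ a b → + 1 * a - + 0 * b ≡ a
  re-*-identityˡ = solve-∀

  im-*-identityˡ : ∀ a b → + 1 * b + + 0 * a + + 0 * b ≡ b
  im-*-identityˡ = solve-∀

  re-*-distribˡ-+ : ∀ a b c d e f →
    a * (c + e) - b * (d + f) ≡ (a * c - b * d) + (a * e - b * f)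
  re-*-distribˡ-+ = solve-∀

  im-*-distribˡ-+ : ∀ a b c d e f →
    a * (d + f) + b * (c + e) + b * (d + f) ≡
    (a * d + b * c + b * d) + (a * f + b * e + b * f)
  im-*-distribˡ-+ = solve-∀

open ComponentIdentities

+ᴱ-assoc : ∀ x y z → (x +ᴱ y) +ᴱ z ≡ x +ᴱ (y +ᴱ z)
+ᴱ-assoc (a + b σ) (c + d σ) (e + f σ) = cong₂ _+_σ (ℤ.+-assoc a c e) (ℤ.+-assoc b d f)

+ᴱ-comm : ∀ x y → x +ᴱ y ≡ y +ᴱ x
+ᴱ-comm (a + b σ) (c + d σ) = cong₂ _+_σ (ℤ.+-comm a c) (ℤ.+-comm b d)

+ᴱ-identityˡ : ∀ x → 0ᴱ +ᴱ x ≡ x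
+ᴱ-identityˡ (a + b σ) = cong₂ _+_σ (ℤ.+-identityˡ a) (ℤ.+-identityˡ b)

+ᴱ-inverseˡ : ∀ x → -ᴱ x +ᴱ x ≡ 0ᴱ
+ᴱ-inverseˡ (a + b σ) = cong₂ _+_σ (ℤ.+-inverseˡ a) (ℤ.+-inverseˡ b)

*ᴱ-assoc : ∀ x y z → (x *ᴱ y) *ᴱ z ≡ x *ᴱ (y *ᴱ z)
*ᴱ-assoc (a + b σ) (c + d σ) (e + f σ) =
  cong₂ _+_σ (re-*-assoc a b c d e f) (im-*-assoc a b c d e f)

*ᴱ-comm : ∀ x y → x *ᴱ y ≡ y *ᴱ x
*ᴱ-comm (a + b σ) (c + d σ) = cong₂ _+_σ (re-*-comm a b c d) (im-*-comm a b c d)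

*ᴱ-identityˡ : ∀ x → 1ᴱ *ᴱ x ≡ x
*ᴱ-identityˡ (a + b σ) = cong₂ _+_σ (re-*-identityˡ a b) (im-*-identityˡ a b)

*ᴱ-distribˡ-+ᴱ : ∀ x y z → x *ᴱ (y +ᴱ z) ≡ x *ᴱ y +ᴱ x *ᴱ z
*ᴱ-distribˡ-+ᴱ (a + b σ) (c + d σ) (e + f σ) =
  cong₂ _+_σ (re-*-distribˡ-+ a b c d e f) (im-*-distribˡ-+ a b c d e f)

𝔼-commutativeRing : CommutativeRing 0ℓ 0ℓ
𝔼-commutativeRing = record
  { Carrier = 𝔼
  ; _≈_ = _≡_
  ; _+_ = _+ᴱ_
  ; _*_ = _*ᴱ_
  ; -_ = -ᴱ_
  ; 0# = 0ᴱ
  ; 1# = 1ᴱ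
  ; isCommutativeRing = record
    { isRing = record
      { +-isAbelianGroup = record
        { isGroup = record
          { isMonoid = record
            { isSemigroup = record
              { isMagma = record { isEquivalence = isEquivalence ; ∙-cong = cong₂ _+ᴱ_ }
              ; assoc = +ᴱ-assoc }
            ; identity = comm∧idˡ⇒id +ᴱ-comm +ᴱ-identityˡ }
          ; inverse = comm∧invˡ⇒inv +ᴱ-comm +ᴱ-inverseˡ
          ; ⁻¹-cong = cong (λ x → -ᴱ x) }
        ; comm = +ᴱ-comm }
      ; *-cong = cong₂ _*ᴱ_
      ; *-assoc = *ᴱ-assoc
      ; *-identity = comm∧idˡ⇒id *ᴱ-comm *ᴱ-identityˡ
      ; distrib = *ᴱ-distribˡ-+ᴱ , comm∧distrˡ⇒distrʳ *ᴱ-comm *ᴱ-distribˡ-+ᴱ }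
    ; *-comm = *ᴱ-comm }
  }

private
  0ᴱ≟_ : (x : 𝔼) → Maybe (0ᴱ ≡ x)
  0ᴱ≟ ((+ zero) + (+ zero) σ) = just refl
  0ᴱ≟ _ = nothing

  𝔼-ring : ACR.AlmostCommutativeRing 0ℓ 0ℓ
  𝔼-ring = ACR.fromCommutativeRing 𝔼-commutativeRing 0ᴱ≟_

*ᴱ-cancelˡ-≡1ᴱ : ∀ {d x y} → d ≡ 1ᴱ → d *ᴱ x ≡ d *ᴱ y → x ≡ y
*ᴱ-cancelˡ-≡1ᴱ {x = x} {y} refl e = trans (sym (*ᴱ-identityˡ x)) (trans e (*ᴱ-identityˡ y))

*ᴱ-identityʳ-≡1ᴱ : ∀ x {d} → d ≡ 1ᴱ → x *ᴱ d ≡ x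
*ᴱ-identityʳ-≡1ᴱ x refl = comm∧idˡ⇒idʳ *ᴱ-comm *ᴱ-identityˡ x

𝔼² : Set
𝔼² = 𝔼 × 𝔼

infixl 7 _∙_
_∙_ : 𝔼² → 𝔼² → 𝔼
(x₁ , x₂) ∙ (y₁ , y₂) = x₁ *ᴱ y₁ +ᴱ x₂ *ᴱ y₂

det₂ : 𝔼² → 𝔼² → 𝔼
det₂ (x₁ , x₂) (y₁ , y₂) = x₁ *ᴱ y₂ -ᴱ y₁ *ᴱ x₂

infixr 8 _*ₗ_
_*ₗ_ : 𝔼 → 𝔼² → 𝔼²
u *ₗ (x₁ , x₂) = u *ᴱ x₁ , u *ᴱ x₂

∙-comm : ∀ x y → x ∙ y ≡ y ∙ x
∙-comm (x₁ , x₂) (y₁ , y₂) = cong₂ _+ᴱ_ (*ᴱ-comm x₁ y₁) (*ᴱ-comm x₂ y₂)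

∙-*ₗ : ∀ u w x y → (u *ₗ x) ∙ (w *ₗ y) ≡ (u *ᴱ w) *ᴱ (x ∙ y)
∙-*ₗ u w (x₁ , x₂) (y₁ , y₂) = identity u w x₁ x₂ y₁ y₂
  where
  identity : ∀ u w x₁ x₂ y₁ y₂ →
    (u *ᴱ x₁) *ᴱ (w *ᴱ y₁) +ᴱ (u *ᴱ x₂) *ᴱ (w *ᴱ y₂) ≡
    (u *ᴱ w) *ᴱ (x₁ *ᴱ y₁ +ᴱ x₂ *ᴱ y₂)
  identity = RingSolver.solve-∀ 𝔼-ring

det₂-*ₗ : ∀ u w x y → det₂ (u *ₗ x) (w *ₗ y) ≡ (u *ᴱ w) *ᴱ det₂ x y
det₂-*ₗ u w (x₁ , x₂) (y₁ , y₂) = identity u w x₁ x₂ y₁ y₂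
  where
  identity : ∀ u w x₁ x₂ y₁ y₂ →
    (u *ᴱ x₁) *ᴱ (w *ᴱ y₂) -ᴱ (w *ᴱ y₁) *ᴱ (u *ᴱ x₂) ≡
    (u *ᴱ w) *ᴱ (x₁ *ᴱ y₂ -ᴱ y₁ *ᴱ x₂)
  identity = RingSolver.solve-∀ 𝔼-ring

∙-injectiveʳ : ∀ u v x y → det₂ u v ≡ 1ᴱ → u ∙ x ≡ u ∙ y → v ∙ x ≡ v ∙ y → x ≡ y
∙-injectiveʳ (u₁ , u₂) (v₁ , v₂) (x₁ , x₂) (y₁ , y₂) δ ux≡uy vx≡vy =
  cong₂ _,_
    (*ᴱ-cancelˡ-≡1ᴱ δ (trans (cramer₁ u₁ u₂ v₁ v₂ x₁ x₂)
      (trans (cong₂ (λ α β → v₂ *ᴱ α -ᴱ u₂ *ᴱ β) ux≡uy vx≡vy) (sym (cramer₁ u₁ u₂ v₁ v₂ y₁ y₂)))))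
    (*ᴱ-cancelˡ-≡1ᴱ δ (trans (cramer₂ u₁ u₂ v₁ v₂ x₁ x₂)
      (trans (cong₂ (λ α β → u₁ *ᴱ β -ᴱ v₁ *ᴱ α) ux≡uy vx≡vy) (sym (cramer₂ u₁ u₂ v₁ v₂ y₁ y₂)))))
  where
  cramer₁ : ∀ u₁ u₂ v₁ v₂ x₁ x₂ →
    (u₁ *ᴱ v₂ -ᴱ v₁ *ᴱ u₂) *ᴱ x₁ ≡
    v₂ *ᴱ (u₁ *ᴱ x₁ +ᴱ u₂ *ᴱ x₂) -ᴱ u₂ *ᴱ (v₁ *ᴱ x₁ +ᴱ v₂ *ᴱ x₂)
  cramer₁ = RingSolver.solve-∀ 𝔼-ring
  cramer₂ : ∀ u₁ u₂ v₁ v₂ x₁ x₂ →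
    (u₁ *ᴱ v₂ -ᴱ v₁ *ᴱ u₂) *ᴱ x₂ ≡
    u₁ *ᴱ (v₁ *ᴱ x₁ +ᴱ v₂ *ᴱ x₂) -ᴱ v₁ *ᴱ (u₁ *ᴱ x₁ +ᴱ u₂ *ᴱ x₂)
  cramer₂ = RingSolver.solve-∀ 𝔼-ring

∙-injectiveˡ : ∀ u v x y → det₂ u v ≡ 1ᴱ → x ∙ u ≡ y ∙ u → x ∙ v ≡ y ∙ v → x ≡ y
∙-injectiveˡ u v x y δ xu≡yu xv≡yv = ∙-injectiveʳ u v x y δ
  (trans (∙-comm u x) (trans xu≡yu (∙-comm y u)))
  (trans (∙-comm v x) (trans xv≡yv (∙-comm y v)))

·ᵛ-∙-invT·ᵛ : ∀ A x y → (A ·ᵛ x) ∙ (invT·ᵛ A y) ≡ x ∙ y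
·ᵛ-∙-invT·ᵛ (mat a b c d det≡1) (x₁ , x₂) (y₁ , y₂) =
  trans (identity a b c d x₁ x₂ y₁ y₂) (trans (cong (_*ᴱ _) det≡1) (*ᴱ-identityˡ _))
  where
  identity : ∀ a b c d x₁ x₂ y₁ y₂ →
    (a *ᴱ x₁ +ᴱ b *ᴱ x₂) *ᴱ (d *ᴱ y₁ -ᴱ c *ᴱ y₂) +ᴱ (c *ᴱ x₁ +ᴱ d *ᴱ x₂) *ᴱ (a *ᴱ y₂ -ᴱ b *ᴱ y₁) ≡
    (a *ᴱ d -ᴱ b *ᴱ c) *ᴱ (x₁ *ᴱ y₁ +ᴱ x₂ *ᴱ y₂)
  identity = RingSolver.solve-∀ 𝔼-ring

det₂-invT·ᵛ : ∀ A x y → det₂ (invT·ᵛ A x) (invT·ᵛ A y) ≡ det₂ x y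
det₂-invT·ᵛ (mat a b c d det≡1) (x₁ , x₂) (y₁ , y₂) =
  trans (identity a b c d x₁ x₂ y₁ y₂) (trans (cong (_*ᴱ _) det≡1) (*ᴱ-identityˡ _))
  where
  identity : ∀ a b c d x₁ x₂ y₁ y₂ →
    (d *ᴱ x₁ -ᴱ c *ᴱ x₂) *ᴱ (a *ᴱ y₂ -ᴱ b *ᴱ y₁) -ᴱ (d *ᴱ y₁ -ᴱ c *ᴱ y₂) *ᴱ (a *ᴱ x₂ -ᴱ b *ᴱ x₁) ≡
    (a *ᴱ d -ᴱ b *ᴱ c) *ᴱ (x₁ *ᴱ y₂ -ᴱ y₁ *ᴱ x₂)
  identity = RingSolver.solve-∀ 𝔼-ring

-- A = (U₀ U₁) · adj (u₀ u₁), writing the vectors as columns.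
transition : ∀ u₀ u₁ U₀ U₁ → det₂ u₀ u₁ ≡ 1ᴱ → det₂ U₀ U₁ ≡ 1ᴱ →
  Σ SL₂ λ A → A ·ᵛ u₀ ≡ U₀ × A ·ᵛ u₁ ≡ U₁
transition (a₀ , b₀) (a₁ , b₁) (A₀ , B₀) (A₁ , B₁) δ Δ =
  mat (A₀ *ᴱ b₁ -ᴱ A₁ *ᴱ b₀) (A₁ *ᴱ a₀ -ᴱ A₀ *ᴱ a₁)
      (B₀ *ᴱ b₁ -ᴱ B₁ *ᴱ b₀) (B₁ *ᴱ a₀ -ᴱ B₀ *ᴱ a₁)
      (trans (det-identity A₀ B₀ A₁ B₁ a₀ b₀ a₁ b₁) (cong₂ _*ᴱ_ Δ δ))
  , cong₂ _,_ (row∙u₀ A₀ A₁) (row∙u₀ B₀ B₁)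
  , cong₂ _,_ (row∙u₁ A₀ A₁) (row∙u₁ B₀ B₁)
  where
  row∙u₀-identity : ∀ X₀ X₁ a₀ b₀ a₁ b₁ →
    (X₀ *ᴱ b₁ -ᴱ X₁ *ᴱ b₀) *ᴱ a₀ +ᴱ (X₁ *ᴱ a₀ -ᴱ X₀ *ᴱ a₁) *ᴱ b₀ ≡ X₀ *ᴱ (a₀ *ᴱ b₁ -ᴱ a₁ *ᴱ b₀)
  row∙u₀-identity = RingSolver.solve-∀ 𝔼-ring
  row∙u₁-identity : ∀ X₀ X₁ a₀ b₀ a₁ b₁ →
    (X₀ *ᴱ b₁ -ᴱ X₁ *ᴱ b₀) *ᴱ a₁ +ᴱ (X₁ *ᴱ a₀ -ᴱ X₀ *ᴱ a₁) *ᴱ b₁ ≡ X₁ *ᴱ (a₀ *ᴱ b₁ -ᴱ a₁ *ᴱ b₀)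
  row∙u₁-identity = RingSolver.solve-∀ 𝔼-ring
  det-identity : ∀ A₀ B₀ A₁ B₁ a₀ b₀ a₁ b₁ →
    (A₀ *ᴱ b₁ -ᴱ A₁ *ᴱ b₀) *ᴱ (B₁ *ᴱ a₀ -ᴱ B₀ *ᴱ a₁) -ᴱ (A₁ *ᴱ a₀ -ᴱ A₀ *ᴱ a₁) *ᴱ (B₀ *ᴱ b₁ -ᴱ B₁ *ᴱ b₀) ≡
    (A₀ *ᴱ B₁ -ᴱ A₁ *ᴱ B₀) *ᴱ (a₀ *ᴱ b₁ -ᴱ a₁ *ᴱ b₀)
  det-identity = RingSolver.solve-∀ 𝔼-ring
  row∙u₀ : ∀ X₀ X₁ → (X₀ *ᴱ b₁ -ᴱ X₁ *ᴱ b₀) *ᴱ a₀ +ᴱ (X₁ *ᴱ a₀ -ᴱ X₀ *ᴱ a₁) *ᴱ b₀ ≡ X₀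
  row∙u₀ X₀ X₁ = trans (row∙u₀-identity X₀ X₁ a₀ b₀ a₁ b₁) (*ᴱ-identityʳ-≡1ᴱ X₀ δ)
  row∙u₁ : ∀ X₀ X₁ → (X₀ *ᴱ b₁ -ᴱ X₁ *ᴱ b₀) *ᴱ a₁ +ᴱ (X₁ *ᴱ a₀ -ᴱ X₀ *ᴱ a₁) *ᴱ b₁ ≡ X₁
  row∙u₁ X₀ X₁ = trans (row∙u₁-identity X₀ X₁ a₀ b₀ a₁ b₁) (*ᴱ-identityʳ-≡1ᴱ X₁ δ)

-- A is fixed by the basis vᵢ₀, vᵢ₁; then each Wⱼ is pinned down by its products with the basis
-- Vᵢ₀, Vᵢ₁, and each Vᵢ by its products with the basis Wⱼ₀, Wⱼ₁.
gram-rigidity : {I J : Set} (v V : I → 𝔼²) (w W : J → 𝔼²) (i₀ i₁ : I) (j₀ j₁ : J) →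
  det₂ (v i₀) (v i₁) ≡ 1ᴱ → det₂ (V i₀) (V i₁) ≡ 1ᴱ → det₂ (w j₀) (w j₁) ≡ 1ᴱ →
  (∀ i j → v i ∙ w j ≡ V i ∙ W j) →
  Σ SL₂ λ A → (∀ i → V i ≡ A ·ᵛ v i) × (∀ j → W j ≡ invT·ᵛ A (w j))
gram-rigidity v V w W i₀ i₁ j₀ j₁ δv δV δw gram = A , V≡Av , W≡A⁻ᵀw
  where
  A : SL₂
  A = proj₁ (transition (v i₀) (v i₁) (V i₀) (V i₁) δv δV)
  Av₀≡V₀ : A ·ᵛ v i₀ ≡ V i₀
  Av₀≡V₀ = proj₁ (proj₂ (transition (v i₀) (v i₁) (V i₀) (V i₁) δv δV))
  Av₁≡V₁ : A ·ᵛ v i₁ ≡ V i₁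
  Av₁≡V₁ = proj₂ (proj₂ (transition (v i₀) (v i₁) (V i₀) (V i₁) δv δV))

  Av∙A⁻ᵀw≡V∙W : ∀ i j → (A ·ᵛ v i) ∙ invT·ᵛ A (w j) ≡ V i ∙ W j
  Av∙A⁻ᵀw≡V∙W i j = trans (·ᵛ-∙-invT·ᵛ A (v i) (w j)) (gram i j)

  W≡A⁻ᵀw : ∀ j → W j ≡ invT·ᵛ A (w j)
  W≡A⁻ᵀw j = ∙-injectiveʳ (V i₀) (V i₁) (W j) (invT·ᵛ A (w j)) δV (same-products i₀ Av₀≡V₀) (same-products i₁ Av₁≡V₁)
    where
    same-products : ∀ i → A ·ᵛ v i ≡ V i → V i ∙ W j ≡ V i ∙ invT·ᵛ A (w j)
    same-products i Avᵢ≡Vᵢ = trans (sym (Av∙A⁻ᵀw≡V∙W i j)) (cong (_∙ invT·ᵛ A (w j)) Avᵢ≡Vᵢ)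

  δW : det₂ (W j₀) (W j₁) ≡ 1ᴱ
  δW = trans (cong₂ det₂ (W≡A⁻ᵀw j₀) (W≡A⁻ᵀw j₁)) (trans (det₂-invT·ᵛ A (w j₀) (w j₁)) δw)

  V≡Av : ∀ i → V i ≡ A ·ᵛ v i
  V≡Av i = ∙-injectiveˡ (W j₀) (W j₁) (V i) (A ·ᵛ v i) δW (same-products j₀) (same-products j₁)
    where
    same-products : ∀ j → V i ∙ W j ≡ (A ·ᵛ v i) ∙ W j
    same-products j = trans (sym (Av∙A⁻ᵀw≡V∙W i j)) (cong ((A ·ᵛ v i) ∙_) (sym (W≡A⁻ᵀw j)))

σ^ℕ-inverse : ∀ x y n → x *ᴱ y ≡ 1ᴱ → σ^ℕ x n *ᴱ σ^ℕ y n ≡ 1ᴱ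
σ^ℕ-inverse x y zero xy≡1 = refl
σ^ℕ-inverse x y (suc n) xy≡1 = begin
  (x *ᴱ σ^ℕ x n) *ᴱ (y *ᴱ σ^ℕ y n)   ≡⟨ interchange x (σ^ℕ x n) y (σ^ℕ y n) ⟩
  (x *ᴱ y) *ᴱ (σ^ℕ x n *ᴱ σ^ℕ y n)   ≡⟨ cong₂ _*ᴱ_ xy≡1 (σ^ℕ-inverse x y n xy≡1) ⟩
  1ᴱ                                 ∎
  where
  open ≡-Reasoning
  open CommutativeSemigroupProperties (CommutativeRing.*-commutativeSemigroup 𝔼-commutativeRing)

σ^-inverseʳ : ∀ m → σ^ m *ᴱ σ^ (ℤ.- m) ≡ 1ᴱ
σ^-inverseʳ (+ zero)  = refl
σ^-inverseʳ (+ suc n) = σ^ℕ-inverse σᴱ σ⁻¹ᴱ (suc n) refl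
σ^-inverseʳ -[1+ n ]  = σ^ℕ-inverse σ⁻¹ᴱ σᴱ (suc n) refl

σ^-inverseˡ : ∀ m → σ^ (ℤ.- m) *ᴱ σ^ m ≡ 1ᴱ
σ^-inverseˡ m = trans (*ᴱ-comm (σ^ (ℤ.- m)) (σ^ m)) (σ^-inverseʳ m)

evenℕ-suc : ∀ n → evenℕ (suc n) ≡ not (evenℕ n)
evenℕ-suc n with evenℕ n
... | true  = refl
... | false = refl

if-then-neg-flip : ∀ {b c} k → c ≡ not b → (if c then k else ℤ.- k) ≡ ℤ.- (if b then k else ℤ.- k)
if-then-neg-flip {true}  k refl = refl
if-then-neg-flip {false} k refl = sym (ℤ.neg-involutive k)

altSign-neg : ∀ i k → altSign i (ℤ.- k) ≡ ℤ.- altSign i k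
altSign-neg i k with evenℕ ℤ.∣ i ∣
... | true  = refl
... | false = refl

altSign-suc : ∀ i k → altSign (ℤ.suc i) k ≡ ℤ.- altSign i k
altSign-suc (+ n)          k = if-then-neg-flip k (evenℕ-suc n)
altSign-suc -[1+ zero ]    k = if-then-neg-flip k refl
altSign-suc -[1+ suc n ]   k = if-then-neg-flip k
  (trans (sym (not-involutive (evenℕ (suc n)))) (cong not (sym (evenℕ-suc (suc n)))))

normalise-isNormalised : ∀ k p q → IsNormalised p q → IsNormalised (normalise k p) (normalise k q)
normalise-isNormalised k p q pq-normalised i = begin
  det₂ (σ^ (altSign i k) *ₗ (p i , q i)) (σ^ (altSign (ℤ.suc i) k) *ₗ (p (ℤ.suc i) , q (ℤ.suc i)))
    ≡⟨ det₂-*ₗ (σ^ (altSign i k)) (σ^ (altSign (ℤ.suc i) k)) (p i , q i) (p (ℤ.suc i) , q (ℤ.suc i)) ⟩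
  (σ^ (altSign i k) *ᴱ σ^ (altSign (ℤ.suc i) k)) *ᴱ det₂ (p i , q i) (p (ℤ.suc i) , q (ℤ.suc i))
    ≡⟨ cong₂ _*ᴱ_ units-cancel (pq-normalised i) ⟩
  1ᴱ
    ∎
  where
  open ≡-Reasoning
  units-cancel : σ^ (altSign i k) *ᴱ σ^ (altSign (ℤ.suc i) k) ≡ 1ᴱ
  units-cancel = trans (cong (λ e → σ^ (altSign i k) *ᴱ σ^ e) (altSign-suc i k)) (σ^-inverseʳ (altSign i k))

normalise-inverse : ∀ k p i → normalise (ℤ.- k) (normalise k p) i ≡ p i
normalise-inverse k p i = begin
  σ^ (altSign i (ℤ.- k)) *ᴱ (σ^ (altSign i k) *ᴱ p i)   ≡⟨ *ᴱ-assoc (σ^ (altSign i (ℤ.- k))) (σ^ (altSign i k)) (p i) ⟨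
  (σ^ (altSign i (ℤ.- k)) *ᴱ σ^ (altSign i k)) *ᴱ p i   ≡⟨ cong (λ e → (σ^ e *ᴱ σ^ (altSign i k)) *ᴱ p i) (altSign-neg i k) ⟩
  (σ^ (ℤ.- altSign i k) *ᴱ σ^ (altSign i k)) *ᴱ p i     ≡⟨ cong (_*ᴱ p i) (σ^-inverseˡ (altSign i k)) ⟩
  1ᴱ *ᴱ p i                                             ≡⟨ *ᴱ-identityˡ (p i) ⟩
  p i                                                   ∎
  where open ≡-Reasoning

scalarProduct-normalise : ∀ k l p q r s i j →
  scalarProduct (normalise k p) (normalise k q) (normalise l r) (normalise l s) i j ≡
  (σ^ (altSign i k) *ᴱ σ^ (altSign j l)) *ᴱ scalarProduct p q r s i j
scalarProduct-normalise k l p q r s i j =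
  ∙-*ₗ (σ^ (altSign i k)) (σ^ (altSign j l)) (p i , q i) (r j , s j)

scalarProduct-normalise-inverse : ∀ k l p q r s i j →
  scalarProduct (normalise (ℤ.- k) (normalise k p)) (normalise (ℤ.- k) (normalise k q))
                (normalise (ℤ.- l) (normalise l r)) (normalise (ℤ.- l) (normalise l s)) i j ≡
  scalarProduct p q r s i j
scalarProduct-normalise-inverse k l p q r s i j =
  cong₂ _+ᴱ_ (cong₂ _*ᴱ_ (normalise-inverse k p i) (normalise-inverse l r j))
             (cong₂ _*ᴱ_ (normalise-inverse k q i) (normalise-inverse l s j))

equivalent-renormalise : ∀ p q r s p' q' r' s' →
  Equivalent (scalarProduct p q r s) (scalarProduct p' q' r' s') →
  Σ ℤ λ k → Σ ℤ λ l → ∀ i j →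
    scalarProduct p q r s i j ≡
    scalarProduct (normalise k p') (normalise k q') (normalise l r') (normalise l s') i j
equivalent-renormalise p q r s p' q' r' s' (P , Q , R , S , _ , _ , k , l , M≡PR , M'≡PᵏRˡ) =
  ℤ.- k , ℤ.- l , λ i j →
    let units = σ^ (altSign i (ℤ.- k)) *ᴱ σ^ (altSign j (ℤ.- l)) in begin
    scalarProduct p q r s i j
      ≡⟨ M≡PR i j ⟩
    scalarProduct P Q R S i j
      ≡⟨ scalarProduct-normalise-inverse k l P Q R S i j ⟨
    scalarProduct (normalise (ℤ.- k) Pᵏ) (normalise (ℤ.- k) Qᵏ) (normalise (ℤ.- l) Rˡ) (normalise (ℤ.- l) Sˡ) i j
      ≡⟨ scalarProduct-normalise (ℤ.- k) (ℤ.- l) Pᵏ Qᵏ Rˡ Sˡ i j ⟩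
    units *ᴱ scalarProduct Pᵏ Qᵏ Rˡ Sˡ i j
      ≡⟨ cong (units *ᴱ_) (M'≡PᵏRˡ i j) ⟨
    units *ᴱ scalarProduct p' q' r' s' i j
      ≡⟨ scalarProduct-normalise (ℤ.- k) (ℤ.- l) p' q' r' s' i j ⟨
    scalarProduct (normalise (ℤ.- k) p') (normalise (ℤ.- k) q') (normalise (ℤ.- l) r') (normalise (ℤ.- l) s') i j
      ∎
  where
  open ≡-Reasoning
  Pᵏ = normalise k P
  Qᵏ = normalise k Q
  Rˡ = normalise l R
  Sˡ = normalise l S

column : Seq → Seq → ℤ → 𝔼²
column p q i = p i , q i

lemma5p17 : (p q r s p' q' r' s' : ℤ → 𝔼) →
    IsNormalised p q → IsNormalised r s →
    IsNormalised p' q' → IsNormalised r' s' →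
    Equivalent (scalarProduct p q r s) (scalarProduct p' q' r' s') →
    Σ SL₂ λ A → Σ ℤ λ k → Σ ℤ λ l →
      (∀ i → (normalise k p' i , normalise k q' i) ≡ A ·ᵛ (p i , q i)) ×
      (∀ j → (normalise l r' j , normalise l s' j) ≡ invT·ᵛ A (r j , s j))
lemma5p17 p q r s p' q' r' s' pq-normalised rs-normalised p'q'-normalised _ equivalent =
  let k , l , same-scalarProduct = equivalent-renormalise p q r s p' q' r' s' equivalent
      A , p'q'≡Apq , r's'≡A⁻ᵀrs =
        gram-rigidity (column p q) (column (normalise k p') (normalise k q'))
                      (column r s) (column (normalise l r') (normalise l s'))
                      (+ 0) (+ 1) (+ 0) (+ 1)
                      (pq-normalised (+ 0))
                      (normalise-isNormalised k p' q' p'q'-normalised (+ 0))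
                      (rs-normalised (+ 0))
                      same-scalarProduct
  in A , k , l , p'q'≡Apq , r's'≡A⁻ᵀrs
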